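{- (Working in $\mathsf{ZF}+\mathsf{DC}$.) For directed sets $(D,\leq_D)$ and $(E,\leq_E)$ the following are equivalent: (1) $(D,\leq_D)\preceq_{pT}(E,\leq_E)$; (2) there is a pre-Tukey map from $(D,\leq_D)$ to $(E,\leq_E)$; (3) there is a pre-convergent map from $(E,\leq_E)$ to $(D,\leq_D)$.
   Context: The base theory is $\mathsf{ZF}+\mathsf{DC}$. A directed set is a pre-ordered set in which every finite set has an upper bound. For $e\in E$, $e\uparrow_{E}=\{e'\in E: e\leq_E e'\}$ and $e\downarrow_{E}=\{e'\in E: e'\leq_E e\}$. $(E,\leq_E)^*$ is the set of non-empty $\leq_E$-upward closed subsets of $E$ ordered by reverse inclusion; a Tukey map $f\colon D\to E$ sends $\leq_D$-unbounded sets to $\leq_E$-unbounded sets; $(D,\leq_D)\preceq_{pT}(E,\leq_E)$ means there is a Tukey map from $(D,\leq_D)$ to $(E,\leq_E)^*$. A pre-Tukey map from $(D,\leq_D)$ to $(E,\leq_E)$ is a map $\pi\colon D\to\mathcal{P}(E)$ with $\pi(d)\neq\emptyset$ for all $d$ and such that for every $e\in E$ there is $d\in D$ with: for all $d'\in D$, if $\pi(d')\cap e\downarrow_E\neq\emptyset$ then $d'\leq_D d$. A pre-convergent map from $(D,\leq_D)$ to $(E,\leq_E)$ is a map $\sigma\colon D\to\mathcal{P}(E)$ with $\sigma(d)\neq\emptyset$ for all $d$ and such that for every $e\in E$ there is $d\in D$ with: for all $d'\in D$, if $d\leq_D d'$ then $\sigma(d')\subseteq e\uparrow_E$. -}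

module Defs where

open import Level using (Level; _⊔_) renaming (suc to lsuc; zero to lzero)
open import Data.Product using (Σ; ∃; _×_; _,_)
open import Data.List using (List)
open import Data.List.Relation.Unary.All using (All)
open import Relation.Nullary using (¬_)
open import Relation.Binary.PropositionalEquality using (_≡_)

record DirectedSet : Set₁ where
  field
    Carrier : Set
    _≤_     : Carrier → Carrier → Set
    refl    : ∀ {x} → x ≤ x
    trans   : ∀ {x y z} → x ≤ y → y ≤ z → x ≤ z
    directed : (xs : List Carrier) → ∃ λ u → All (λ x → x ≤ u) xs

Bounded : ∀ {a b ℓ} {C : Set a} (R : C → C → Set b) (X : C → Set ℓ) → Set (a ⊔ b ⊔ ℓ)
Bounded {C = C} R X = ∃ λ (c : C) → ∀ x → X x → R x c

Unbounded : ∀ {a b ℓ} {C : Set a} (R : C → C → Set b) (X : C → Set ℓ) → Set (a ⊔ b ⊔ ℓ)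
Unbounded R X = ¬ Bounded R X

Image : ∀ {a a' ℓ} {C : Set a} {C' : Set a'} (f : C → C') (X : C → Set ℓ) → C' → Set (a ⊔ a' ⊔ ℓ)
Image {C = C} f X c' = ∃ λ (c : C) → X c × f c ≡ c'

IsTukey : ∀ {a b a' b'} {C : Set a} {C' : Set a'} (R : C → C → Set b) (R' : C' → C' → Set b')
          (f : C → C') → Set (lsuc lzero ⊔ a ⊔ b ⊔ a' ⊔ b')
IsTukey R R' f = (X : _ → Set) → Unbounded R X → Unbounded R' (Image f X)

module _ (E : DirectedSet) where
  open DirectedSet E

  UpwardClosed : (Carrier → Set) → Set
  UpwardClosed A = ∀ {x y} → x ≤ y → A x → A y

  record StarElem : Set₁ where
    field
      set       : Carrier → Set
      nonempty  : ∃ set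
      upclosed  : UpwardClosed set

  _≤*_ : StarElem → StarElem → Set
  A ≤* B = ∀ e → StarElem.set B e → StarElem.set A e

_≼pT_ : DirectedSet → DirectedSet → Set₁
D ≼pT E = ∃ λ (f : DirectedSet.Carrier D → StarElem E) →
            IsTukey (DirectedSet._≤_ D) (_≤*_ E) f

_↑_ : (E : DirectedSet) → DirectedSet.Carrier E → DirectedSet.Carrier E → Set
(E ↑ e) e' = DirectedSet._≤_ E e e'

_↓_ : (E : DirectedSet) → DirectedSet.Carrier E → DirectedSet.Carrier E → Set
(E ↓ e) e' = DirectedSet._≤_ E e' e

IsPreTukey : (D E : DirectedSet) → (DirectedSet.Carrier D → DirectedSet.Carrier E → Set) → Set
IsPreTukey D E π =
  (∀ d → ∃ (π d)) ×
  (∀ e → ∃ λ d → ∀ d' → (∃ λ e' → π d' e' × (E ↓ e) e') → DirectedSet._≤_ D d' d)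

IsPreConvergent : (D E : DirectedSet) → (DirectedSet.Carrier D → DirectedSet.Carrier E → Set) → Set
IsPreConvergent D E σ =
  (∀ d → ∃ (σ d)) ×
  (∀ e → ∃ λ d → ∀ d' → DirectedSet._≤_ D d d' → ∀ e' → σ d' e' → (E ↑ e) e')

HasPreTukey : DirectedSet → DirectedSet → Set₁
HasPreTukey D E = ∃ λ π → IsPreTukey D E π

HasPreConvergent : DirectedSet → DirectedSet → Set₁
HasPreConvergent D E = ∃ λ σ → IsPreConvergent D E σ

{-# OPTIONS --safe #-}
-- A map f : D → E* is Tukey exactly when every fibre {d | e ∈ f d} is
-- bounded: f sends that fibre below the principal upset ↑e, and conversely
-- any e in an upper bound of f[X] puts X inside the fibre of e.  Fibres of
-- the upward closure of a pre-Tukey π are the sets {d | π d meets e↓}, which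
-- gives (1) ⇔ (2); only the passage from Tukey to bounded fibres needs
-- excluded middle.  For (2) ⇔ (3), σ(e) is the set of upper bounds of
-- {d | π d meets e↓}, and back, π(d) is the set of e from which σ stays
-- above d.
module Submission where

open import Defs
open import Level using (0ℓ; _⊔_)
open import Data.Product using (_×_; _,_; ∃)
open import Function.Bundles using (_⇔_; mk⇔)
open import Axiom.ExcludedMiddle using (ExcludedMiddle)
open import Axiom.DoubleNegationElimination using (em⇒dne)
open import Relation.Binary.PropositionalEquality using (refl)

module _ {a a′ b b′} {C : Set a} {C′ : Set a′}
         {R : C → C → Set b} {R′ : C′ → C′ → Set b′} {f : C → C′} where

  tukey-reflects-bounded : ExcludedMiddle (a ⊔ b) → IsTukey R R′ f →
                           (X : C → Set) → Bounded R′ (Image f X) → Bounded R X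
  tukey-reflects-bounded em tukey X bounded =
    em⇒dne em (λ unbounded → tukey X unbounded bounded)

IsUpperBound : ∀ {a b ℓ} {C : Set a} (R : C → C → Set b) (X : C → Set ℓ) → C →
               Set (a ⊔ b ⊔ ℓ)
IsUpperBound R X c = ∀ x → X x → R x c

module _ (E : DirectedSet) where
  open DirectedSet E using (Carrier; _≤_) renaming (refl to ≤-refl; trans to ≤-trans)
  open StarElem

  principalUpset : Carrier → StarElem E
  principalUpset e = record
    { set      = E ↑ e
    ; nonempty = e , ≤-refl
    ; upclosed = λ x≤y e≤x → ≤-trans e≤x x≤y
    }

  upwardClosure : (A : Carrier → Set) → ∃ A → StarElem E
  upwardClosure A (a , a∈A) = record
    { set      = λ e → ∃ λ e′ → A e′ × e′ ≤ e
    ; nonempty = a , a , a∈A , ≤-refl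
    ; upclosed = λ { x≤y (e′ , e′∈A , e′≤x) → e′ , e′∈A , ≤-trans e′≤x x≤y }
    }

  ≤*-principalUpset : (A : StarElem E) {e : Carrier} → set A e → _≤*_ E A (principalUpset e)
  ≤*-principalUpset A e∈A e′ e≤e′ = upclosed A e≤e′ e∈A

module _ (D E : DirectedSet) where
  private
    module D = DirectedSet D
    module E = DirectedSet E
  open StarElem

  BoundedFibres : (D.Carrier → StarElem E) → Set
  BoundedFibres f = ∀ e → Bounded D._≤_ (λ d → set (f d) e)

  boundedFibres⇒tukey : (f : D.Carrier → StarElem E) → BoundedFibres f →
                        IsTukey D._≤_ (_≤*_ E) f
  boundedFibres⇒tukey f bounded X unbounded (A , A-bound) =
    let (e , e∈A)     = nonempty A
        (d , d-bound) = bounded e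
    in unbounded (d , λ x x∈X → d-bound x (A-bound (f x) (x , x∈X , refl) e e∈A))

  tukey⇒boundedFibres : ExcludedMiddle 0ℓ → (f : D.Carrier → StarElem E) →
                        IsTukey D._≤_ (_≤*_ E) f → BoundedFibres f
  tukey⇒boundedFibres em f tukey e =
    tukey-reflects-bounded em tukey _
      (principalUpset E e , λ { _ (d , e∈fd , refl) → ≤*-principalUpset E (f d) e∈fd })

  MeetsBelow : (D.Carrier → E.Carrier → Set) → E.Carrier → D.Carrier → Set
  MeetsBelow π e d = ∃ λ e′ → π d e′ × (E ↓ e) e′

  EventuallyAbove : (E.Carrier → D.Carrier → Set) → D.Carrier → E.Carrier → Set
  EventuallyAbove σ d e = ∀ e′ → e E.≤ e′ → ∀ d′ → σ e′ d′ → d D.≤ d′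

  ≼pT⇒HasPreTukey : ExcludedMiddle 0ℓ → D ≼pT E → HasPreTukey D E
  ≼pT⇒HasPreTukey em (f , tukey) = (λ d → set (f d)) , (λ d → nonempty (f d)) , bounded
    where
    bounded : ∀ e → Bounded D._≤_ (MeetsBelow (λ d → set (f d)) e)
    bounded e =
      let (d , d-bound) = tukey⇒boundedFibres em f tukey e
      in d , λ { d′ (e′ , e′∈fd′ , e′≤e) → d-bound d′ (upclosed (f d′) e′≤e e′∈fd′) }

  HasPreTukey⇒≼pT : HasPreTukey D E → D ≼pT E
  HasPreTukey⇒≼pT (π , nonempty , bounded) = f , boundedFibres⇒tukey f bounded
    where
    f : D.Carrier → StarElem E
    f d = upwardClosure E (π d) (nonempty d)

  HasPreTukey⇒HasPreConvergent : HasPreTukey D E → HasPreConvergent E D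
  HasPreTukey⇒HasPreConvergent (π , nonempty , bounded) = σ , bounded , converges
    where
    σ : E.Carrier → D.Carrier → Set
    σ e = IsUpperBound D._≤_ (MeetsBelow π e)

    converges : ∀ d → ∃ (EventuallyAbove σ d)
    converges d =
      let (e , e∈πd) = nonempty d
      in e , λ e′ e≤e′ d′ d′-bound → d′-bound d (e , e∈πd , e≤e′)

  HasPreConvergent⇒HasPreTukey : HasPreConvergent E D → HasPreTukey D E
  HasPreConvergent⇒HasPreTukey (σ , nonempty , converges) = EventuallyAbove σ , converges , bounded
    where
    bounded : ∀ e → Bounded D._≤_ (MeetsBelow (EventuallyAbove σ) e)
    bounded e =
      let (d , d∈σe) = nonempty e
      in d , λ { d′ (e′ , above , e′≤e) → above e e′≤e d d∈σe }

mainTheorem11 : (lem : ∀ {ℓ} → ExcludedMiddle ℓ) → (D E : DirectedSet) →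
    ((D ≼pT E) ⇔ HasPreTukey D E) × (HasPreTukey D E ⇔ HasPreConvergent E D)
mainTheorem11 lem D E =
  mk⇔ (≼pT⇒HasPreTukey D E lem) (HasPreTukey⇒≼pT D E) ,
  mk⇔ (HasPreTukey⇒HasPreConvergent D E) (HasPreConvergent⇒HasPreTukey D E)
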